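{- Let $\mathbf x,\mathbf y$ be sprinklers, $\Phi$ a bouquet, $\Delta$ a corolla, and $\sigma:\mathbf y$ a substitution capture-avoiding in $(\emptyset\cdot\Phi\rhd\Delta)$. Then $(\mathbf x\cup\mathbf y)\cdot\Phi\rhd\Delta\ \models\ \mathbf x\cdot\sigma(\Phi)\rhd\sigma(\Delta)$.
   Context: Fix a countable set $\mathcal{V}$ of variables and a first-order signature: a countable set $\mathcal{P}$ of predicate symbols with arities $\mathrm{ar}:\mathcal{P}\to\mathbb{N}$. Flowers and gardens by mutual induction: atoms $p(\vec x)$ ($\vec x\in\mathcal V^{\mathrm{ar}(p)}$) are flowers; if $\mathbf{x}\subset\mathcal{V}$ is finite (a sprinkler) and $\Phi$ a finite multiset of flowers (a bouquet), $\mathbf{x}\cdot\Phi$ is a garden; if $\gamma$ is a garden (pistil) and $\Delta$ a finite multiset of gardens (a corolla of petals), $\gamma\rhd\Delta$ is a flower, also written $\gamma\rhd\delta_1;\dots;\delta_n$. Free variables: $\mathrm{fv}(p(\vec x))$ = variables of $\vec x$; $\mathrm{fv}(\Phi)=\bigcup\mathrm{fv}(\phi)$; $\mathrm{fv}(\mathbf{x}\cdot\Phi)=\mathrm{fv}(\Phi)\setminus\mathbf{x}$; $\mathrm{fv}(\mathbf{x}\cdot\Phi\rhd\Delta)=\mathrm{fv}(\mathbf{x}\cdot\Phi)\cup\bigcup_{\mathbf{y}\cdot\Psi\in\Delta}\mathrm{fv}((\mathbf{x}\cup\mathbf{y})\cdot\Psi)$. Bound variables: $\mathrm{bv}(p(\vec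 x))=\emptyset$, $\mathrm{bv}(\Phi)=\bigcup\mathrm{bv}(\phi)$, $\mathrm{bv}(\mathbf x\cdot\Phi)=\mathbf x\cup\mathrm{bv}(\Phi)$, $\mathrm{bv}(\gamma\rhd\Delta)=\mathrm{bv}(\gamma)\cup\bigcup_{\delta\in\Delta}\mathrm{bv}(\delta)$. Standing convention: every flower/bouquet considered has pairwise distinct binders and $\mathrm{bv}\cap\mathrm{fv}=\emptyset$. Updates and substitutions: $f[R\mapsto g]$ equals $g$ on $R$ and $f$ elsewhere. A substitution is $\sigma:\mathcal V\to\mathcal V$ with finite support; $\sigma:\mathbf y$ means support $\mathbf y$; $\sigma_{ -\mathbf x}:=\sigma[\mathbf x\mapsto\mathrm{id}]$. Action: $\sigma(p(x_1,\dots,x_n))=p(\sigma(x_1),\dots,\sigma(x_n))$, elementwise on bouquets and corollas, $\sigma(\mathbf x\cdot\Phi)=\mathbf x\cdot\sigma_{ -\mathbf x}(\Phi)$, $\sigma(\mathbf x\cdot\Phi\rhd\delta_1;\dots;\delta_n)=\sigma(\mathbf x\cdot\Phi)\rhd\sigma_{ -\mathbf x}(\delta_1);\dots;\sigma_{ -\mathbf x}(\delta_n)$. $\sigma:\mathbf y$ is capture-avoiding in $\phi$ if $\sigma(\mathbf y)\cap\mathrm{bv}(\phi)=\emptyset$. Semantics: a Kripke structure $(W,\le,(M_w)_{w\in W})$ has a preorder $\le$ on worlds and for each $w$ a nonempty domain $M_w$ and relations $[\![p]\!]_w\subseteq M_w^{\mathrm{ar}(p)}$, monotone along $\le$. A $w$-evaluation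 is $e:\mathcal V\to M_w$. Forcing: $w\Vdash_e p(x_1,\dots,x_n)$ iff $(e(x_1),\dots,e(x_n))\in[\![p]\!]_w$; $w\Vdash_e\Phi$ iff $w\Vdash_e\phi$ for all $\phi\in\Phi$; $w\Vdash_e(\mathbf x\cdot\Phi\rhd\mathbf x_1\cdot\Phi_1;\dots;\mathbf x_n\cdot\Phi_n)$ iff for every $w'\ge w$ and $w'$-evaluation $e'$ with $w'\Vdash_{e[\mathbf x\mapsto e']}\Phi$, there are $i$ and a $w'$-evaluation $e''$ with $w'\Vdash_{e[\mathbf x\mapsto e'][\mathbf x_i\mapsto e'']}\Phi_i$. For flowers $\phi,\psi$, $\phi\models\psi$ means that in every Kripke structure, at every world $w$ and $w$-evaluation $e$, $w\Vdash_e\phi$ implies $w\Vdash_e\psi$. -}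

module Defs where

open import Level using (Level; _⊔_; 0ℓ) renaming (suc to lsuc)
open import Data.Nat using (ℕ)
open import Data.Nat.Properties using (_≟_)
open import Data.Bool using (if_then_else_)
open import Data.List using (List; []; _∷_; _++_)
open import Data.List.Membership.Propositional using (_∈_; _∉_)
open import Data.List.Membership.DecPropositional _≟_ using (_∈?_)
open import Data.List.Relation.Unary.Any using (Any)
open import Data.List.Relation.Unary.AllPairs using (AllPairs)
open import Data.List.Relation.Binary.Disjoint.Propositional using (Disjoint)
open import Data.Vec using (Vec; toList)
import Data.Vec as Vec
open import Data.Product using (Σ; _×_; ∃)
open import Data.Sum using (_⊎_)
open import Data.Empty.Polymorphic using (⊥)
open import Relation.Nullary using (¬_; does)
open import Relation.Binary.PropositionalEquality using (_≡_)
open import Function.Bundles using (_⇔_)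

-- Signature: a countable set of predicate symbols with arities.
-- Variables 𝒱 are ℕ.  Countability of the predicate symbols is
-- witnessed by an injection into ℕ.

record Signature : Set₁ where
  field
    Pred     : Set
    ar       : Pred → ℕ
    code     : Pred → ℕ
    code-inj : ∀ {p q} → code p ≡ code q → p ≡ q

open Signature public

-- Sprinklers: finite sets of variables, represented by lists
-- (only membership matters).  Bouquets/corollas: finite multisets,
-- represented by lists.
Sprinkler : Set
Sprinkler = List ℕ

_∪_ : Sprinkler → Sprinkler → Sprinkler
x ∪ y = x ++ y

infixr 6 _∪_
infix 5 _·_
infix 4 _▷_

mutual
  data Flower (S : Signature) : Set where
    atom : (p : Pred S) → Vec ℕ (ar S p) → Flower S
    _▷_  : Garden S → List (Garden S) → Flower S

  data Garden (S : Signature) : Set where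
    _·_ : Sprinkler → List (Flower S) → Garden S

sprinkler : ∀ {S} → Garden S → Sprinkler
sprinkler (x · _) = x

_[_↦_] : {a : Level} {A : Set a} → (ℕ → A) → Sprinkler → (ℕ → A) → (ℕ → A)
(f [ R ↦ g ]) v = if does (v ∈? R) then g v else f v

Subst : Set
Subst = ℕ → ℕ

HasSupport : Subst → Sprinkler → Set
HasSupport σ y = ∀ v → (¬ (σ v ≡ v)) ⇔ (v ∈ y)

_₋_ : Subst → Sprinkler → Subst
σ ₋ x = σ [ x ↦ (λ v → v) ]

mutual
  substF : ∀ {S} → Subst → Flower S → Flower S
  substF σ (atom p xs) = atom p (Vec.map σ xs)
  substF σ (γ ▷ Δ)     = substG σ γ ▷ substGs (σ ₋ sprinkler γ) Δ

  substG : ∀ {S} → Subst → Garden S → Garden S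
  substG σ (x · Φ) = x · substFs (σ ₋ x) Φ

  substFs : ∀ {S} → Subst → List (Flower S) → List (Flower S)
  substFs σ []      = []
  substFs σ (φ ∷ Φ) = substF σ φ ∷ substFs σ Φ

  substGs : ∀ {S} → Subst → List (Garden S) → List (Garden S)
  substGs σ []      = []
  substGs σ (δ ∷ Δ) = substG σ δ ∷ substGs σ Δ

-- Bound variables (as the list of all sprinklers occurring, so that
-- "pairwise distinct binders" can be expressed) and free variables.

mutual
  bindersF : ∀ {S} → Flower S → List Sprinkler
  bindersF (atom p xs) = []
  bindersF (γ ▷ Δ)     = bindersG γ ++ bindersGs Δ

  bindersG : ∀ {S} → Garden S → List Sprinkler
  bindersG (x · Φ) = x ∷ bindersFs Φ

  bindersFs : ∀ {S} → List (Flower S) → List Sprinkler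
  bindersFs []      = []
  bindersFs (φ ∷ Φ) = bindersF φ ++ bindersFs Φ

  bindersGs : ∀ {S} → List (Garden S) → List Sprinkler
  bindersGs []      = []
  bindersGs (δ ∷ Δ) = bindersG δ ++ bindersGs Δ

_∈bv_ : ∀ {S} → ℕ → Flower S → Set
v ∈bv φ = Any (v ∈_) (bindersF φ)

mutual
  _∈fvF_ : ∀ {S} → ℕ → Flower S → Set
  v ∈fvF atom p xs = v ∈ toList xs
  v ∈fvF (x · Φ ▷ Δ) = v ∈fvG (x · Φ) ⊎ v ∈fvPetals x , Δ

  _∈fvFs_ : ∀ {S} → ℕ → List (Flower S) → Set
  v ∈fvFs []      = ⊥ {0ℓ}
  v ∈fvFs (φ ∷ Φ) = v ∈fvF φ ⊎ v ∈fvFs Φ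

  _∈fvG_ : ∀ {S} → ℕ → Garden S → Set
  v ∈fvG (x · Φ) = v ∉ x × v ∈fvFs Φ

  _∈fvPetals_,_ : ∀ {S} → ℕ → Sprinkler → List (Garden S) → Set
  v ∈fvPetals x , []      = ⊥ {0ℓ}
  v ∈fvPetals x , ((y · Ψ) ∷ Δ) = (v ∉ (x ∪ y) × v ∈fvFs Ψ) ⊎ v ∈fvPetals x , Δ

WellFormed : ∀ {S} → Flower S → Set
WellFormed φ = AllPairs Disjoint (bindersF φ) × (∀ v → v ∈bv φ → ¬ (v ∈fvF φ))

CaptureAvoiding : ∀ {S} → Subst → Sprinkler → Flower S → Set
CaptureAvoiding σ y φ = ∀ v → v ∈ y → ¬ (σ v ∈bv φ)

-- Kripke semantics (domains presented as predicates on a common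
-- carrier D, so that M_w ⊆ M_w' for w ≤ w' is literal inclusion).

record Kripke (ℓ : Level) (S : Signature) : Set (lsuc ℓ) where
  field
    W        : Set ℓ
    _≤_      : W → W → Set ℓ
    ≤-refl   : ∀ {w} → w ≤ w
    ≤-trans  : ∀ {u v w} → u ≤ v → v ≤ w → u ≤ w
    D        : Set ℓ
    M        : W → D → Set ℓ
    M-nonempty : ∀ w → Σ D (M w)
    M-mono   : ∀ {w w' d} → w ≤ w' → M w d → M w' d
    rel      : W → (p : Pred S) → Vec D (ar S p) → Set ℓ
    rel-dom  : ∀ {w p ds} → rel w p ds → ∀ {d} → d ∈ toList ds → M w d
    rel-mono : ∀ {w w' p ds} → w ≤ w' → rel w p ds → rel w' p ds

  IsEval : W → (ℕ → D) → Set ℓ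
  IsEval w e = ∀ v → M w (e v)

  mutual
    forceF : W → (ℕ → D) → Flower S → Set ℓ
    forceF w e (atom p xs)   = rel w p (Vec.map e xs)
    forceF w e (x · Φ ▷ Δ) =
      ∀ w' → w ≤ w' → ∀ e' → IsEval w' e' →
      forceFs w' (e [ x ↦ e' ]) Φ → forcePetals w' (e [ x ↦ e' ]) Δ

    forceFs : W → (ℕ → D) → List (Flower S) → Set ℓ
    forceFs w e []      = Level.Lift ℓ Data.Unit.⊤
      where import Data.Unit
    forceFs w e (φ ∷ Φ) = forceF w e φ × forceFs w e Φ

    forcePetals : W → (ℕ → D) → List (Garden S) → Set ℓ
    forcePetals w e []            = ⊥
    forcePetals w e ((y · Ψ) ∷ Δ) =
      Σ (ℕ → D) (λ e'' → IsEval w e'' × forceFs w (e [ y ↦ e'' ]) Ψ)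
      ⊎ forcePetals w e Δ

_⊨_ : ∀ {ℓ S} → Flower S → Flower S → Set (lsuc ℓ)
_⊨_ {ℓ} {S} φ ψ =
  (K : Kripke ℓ S) → let open Kripke K in
  ∀ w e → IsEval w e → forceF w e φ → forceF w e ψ

{-# OPTIONS --safe #-}
module Submission where

open import Defs
open import Level using (Level)
open import Data.Nat using (ℕ)
open import Data.Nat.Properties using (_≟_)
open import Data.List using (List; []; _∷_; _++_)
open import Data.List.Membership.Propositional using (_∈_; _∉_)
open import Data.List.Membership.DecPropositional _≟_ using (_∈?_)
open import Data.List.Relation.Unary.All as All using (All; []; _∷_)
open import Data.List.Relation.Unary.All.Properties using (++⁻ˡ; ++⁻ʳ)
open import Data.List.Relation.Unary.Any using (Any; here; there)
open import Data.List.Relation.Unary.Any.Properties using (++⁺ˡ; ++⁺ʳ)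
import Data.Vec as Vec
open import Data.Vec.Properties using (map-∘; map-cong)
open import Data.Sum using (inj₁; inj₂)
import Data.Product.Function.Dependent.Propositional as Σ
open import Data.Product.Function.NonDependent.Propositional using (_×-⇔_)
open import Data.Sum.Function.Propositional using (_⊎-⇔_)
open import Function using (_∘_; id; _⇔_; mk⇔; Equivalence)
open import Function.Properties.Equivalence using () renaming (refl to ⇔-refl)
open import Function.Related.Propositional using (equivalence)
open import Function.Related.TypeIsomorphisms using (→-cong-⇔)
open import Relation.Nullary using (¬_; yes; no; contradiction)
open import Relation.Nullary.Decidable using (toSum; decidable-stable)
open import Relation.Binary.PropositionalEquality
  using (_≡_; _≢_; _≗_; refl; sym; trans; cong; subst; module ≡-Reasoning)

open Equivalence using (to; from)

-- Substitution lemma: if e₂ ≗ e₁ ∘ σ and no variable moved by σ lands in a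
-- binder, then e₁ forces σ(φ) iff e₂ forces φ.  For the theorem, extend e by
-- an evaluation e' of x to e₁ and instantiate the premise's binder x ∪ y by
-- e₁ ∘ σ.  As σ is the identity off y, the resulting evaluation agrees with
-- e₁ ∘ σ everywhere, so the substitution lemma carries σ(Φ) into the premise
-- and the chosen petal back to σ(Δ).

update-∈ : ∀ {a} {A : Set a} (f g : ℕ → A) {R v} → v ∈ R → (f [ R ↦ g ]) v ≡ g v
update-∈ f g {R} {v} v∈R with v ∈? R
... | yes _   = refl
... | no v∉R = contradiction v∈R v∉R

update-∉ : ∀ {a} {A : Set a} (f g : ℕ → A) {R v} → v ∉ R → (f [ R ↦ g ]) v ≡ f v
update-∉ f g {R} {v} v∉R with v ∈? R
... | yes v∈R = contradiction v∈R v∉R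
... | no _     = refl

₋-∈ : ∀ (σ : Subst) {x v} → v ∈ x → (σ ₋ x) v ≡ v
₋-∈ σ = update-∈ σ id

₋-∉ : ∀ (σ : Subst) {x v} → v ∉ x → (σ ₋ x) v ≡ σ v
₋-∉ σ = update-∉ σ id

SupportedIn : Subst → Sprinkler → Set
SupportedIn σ y = ∀ v → σ v ≢ v → v ∈ y

fixed-outside : ∀ {σ y v} → SupportedIn σ y → v ∉ y → σ v ≡ v
fixed-outside {σ} {v = v} supported v∉y =
  decidable-stable (σ v ≟ v) (v∉y ∘ supported v)

MovesOutside : Subst → Sprinkler → Set
MovesOutside σ b = ∀ v → σ v ≢ v → σ v ∉ b

CaptureFree : Subst → List Sprinkler → Set
CaptureFree σ = All (MovesOutside σ)

captureFree : ∀ {σ} Bs → (∀ v → σ v ≢ v → ¬ Any (σ v ∈_) Bs) → CaptureFree σ Bs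
captureFree []       _     = []
captureFree (b ∷ Bs) avoid =
  (λ v moved → avoid v moved ∘ here) ∷ captureFree Bs (λ v moved → avoid v moved ∘ there)

image-∉ : ∀ {σ x v} → MovesOutside σ x → v ∉ x → σ v ∉ x
image-∉ {σ} {x} {v} moves v∉x with σ v ≟ v
... | yes σv≡v = subst (_∉ x) (sym σv≡v) v∉x
... | no  σv≢v = moves v σv≢v

-- Case splits below go through toSum (v ∈? x), not v ∈? x: otherwise `with`
-- rewrites the decision hidden inside the updates of the goal.
MovesOutside-₋ : ∀ {σ x b} → MovesOutside σ b → MovesOutside (σ ₋ x) b
MovesOutside-₋ {σ} {x} {b} moves v moved with toSum (v ∈? x)
... | inj₁ v∈x = contradiction (₋-∈ σ v∈x) moved
... | inj₂ v∉x = subst (_∉ b) (sym (₋-∉ σ v∉x)) (moves v (moved ∘ trans (₋-∉ σ v∉x)))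

CaptureFree-₋ : ∀ {σ Bs} x → CaptureFree σ Bs → CaptureFree (σ ₋ x) Bs
CaptureFree-₋ x = All.map (MovesOutside-₋ {x = x})

module _ {a} {A : Set a} where
  open ≡-Reasoning

  update-∘-₋ : ∀ {σ x} (e₁ : ℕ → A) {e₂ : ℕ → A} → e₂ ≗ e₁ ∘ σ → MovesOutside σ x →
               ∀ e' → e₂ [ x ↦ e' ] ≗ (e₁ [ x ↦ e' ]) ∘ (σ ₋ x)
  update-∘-₋ {σ} {x} e₁ {e₂} agree moves e' v with toSum (v ∈? x)
  ... | inj₁ v∈x = begin
    (e₂ [ x ↦ e' ]) v            ≡⟨ update-∈ e₂ e' v∈x ⟩
    e' v                         ≡⟨ update-∈ e₁ e' v∈x ⟨
    (e₁ [ x ↦ e' ]) v            ≡⟨ cong (e₁ [ x ↦ e' ]) (₋-∈ σ v∈x) ⟨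
    (e₁ [ x ↦ e' ]) ((σ ₋ x) v)  ∎
  ... | inj₂ v∉x = begin
    (e₂ [ x ↦ e' ]) v            ≡⟨ update-∉ e₂ e' v∉x ⟩
    e₂ v                         ≡⟨ agree v ⟩
    e₁ (σ v)                     ≡⟨ update-∉ e₁ e' (image-∉ moves v∉x) ⟨
    (e₁ [ x ↦ e' ]) (σ v)        ≡⟨ cong (e₁ [ x ↦ e' ]) (₋-∉ σ v∉x) ⟨
    (e₁ [ x ↦ e' ]) ((σ ₋ x) v)  ∎

  update-∪-∘ : ∀ {σ y} x (e e₁ : ℕ → A) → SupportedIn σ y → (∀ {v} → v ∉ x → e₁ v ≡ e v) →
               e [ x ∪ y ↦ e₁ ∘ σ ] ≗ e₁ ∘ σ
  update-∪-∘ {σ} {y} x e e₁ supported agree-off-x v with toSum (v ∈? (x ∪ y))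
  ... | inj₁ v∈x∪y = update-∈ e (e₁ ∘ σ) v∈x∪y
  ... | inj₂ v∉x∪y = begin
    (e [ x ∪ y ↦ e₁ ∘ σ ]) v  ≡⟨ update-∉ e (e₁ ∘ σ) v∉x∪y ⟩
    e v                       ≡⟨ agree-off-x (v∉x∪y ∘ ++⁺ˡ) ⟨
    e₁ v                      ≡⟨ cong e₁ (fixed-outside supported (v∉x∪y ∘ ++⁺ʳ x)) ⟨
    e₁ (σ v)                  ∎

module _ {ℓ : Level} {S : Signature} (K : Kripke ℓ S) where
  open Kripke K

  IsEval-update : ∀ {w w' e e'} x → IsEval w e → w ≤ w' → IsEval w' e' → IsEval w' (e [ x ↦ e' ])
  IsEval-update x e-eval w≤w' e'-eval v with v ∈? x
  ... | yes _ = e'-eval v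
  ... | no  _ = M-mono w≤w' (e-eval v)

  mutual
    forceF-subst : ∀ {w σ e₁ e₂} (φ : Flower S) → e₂ ≗ e₁ ∘ σ → CaptureFree σ (bindersF φ) →
                   forceF w e₁ (substF σ φ) ⇔ forceF w e₂ φ
    forceF-subst {w} {σ} {e₁} {e₂} (atom p xs) agree _ =
      mk⇔ (subst (rel w p) same) (subst (rel w p) (sym same))
      where
      same : Vec.map e₁ (Vec.map σ xs) ≡ Vec.map e₂ xs
      same = sym (trans (map-cong agree xs) (map-∘ e₁ σ xs))
    forceF-subst {σ = σ} {e₁} {e₂} (x · Φ ▷ Δ) agree (x-safe ∷ safe) =
      mk⇔ (λ h w' w≤w' e' e'-eval → to   (body e') (h w' w≤w' e' e'-eval))
          (λ h w' w≤w' e' e'-eval → from (body e') (h w' w≤w' e' e'-eval))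
      where
      agree-under : ∀ e' → e₂ [ x ↦ e' ] ≗ (e₁ [ x ↦ e' ]) ∘ (σ ₋ x)
      agree-under = update-∘-₋ e₁ agree x-safe
      body : ∀ {w'} e' →
             (forceFs w' (e₁ [ x ↦ e' ]) (substFs (σ ₋ x) Φ) →
              forcePetals w' (e₁ [ x ↦ e' ]) (substGs (σ ₋ x) Δ))
             ⇔ (forceFs w' (e₂ [ x ↦ e' ]) Φ → forcePetals w' (e₂ [ x ↦ e' ]) Δ)
      body e' =
        →-cong-⇔ (forceFs-subst Φ (agree-under e') (++⁻ˡ (bindersFs Φ) (CaptureFree-₋ x safe)))
                 (forcePetals-subst Δ (agree-under e') (++⁻ʳ (bindersFs Φ) (CaptureFree-₋ x safe)))

    forceFs-subst : ∀ {w σ e₁ e₂} (Φ : List (Flower S)) → e₂ ≗ e₁ ∘ σ → CaptureFree σ (bindersFs Φ) →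
                    forceFs w e₁ (substFs σ Φ) ⇔ forceFs w e₂ Φ
    forceFs-subst []      _     _    = ⇔-refl
    forceFs-subst (φ ∷ Φ) agree safe =
      forceF-subst φ agree (++⁻ˡ (bindersF φ) safe) ×-⇔ forceFs-subst Φ agree (++⁻ʳ (bindersF φ) safe)

    forcePetals-subst : ∀ {w σ e₁ e₂} (Δ : List (Garden S)) → e₂ ≗ e₁ ∘ σ → CaptureFree σ (bindersGs Δ) →
                        forcePetals w e₁ (substGs σ Δ) ⇔ forcePetals w e₂ Δ
    forcePetals-subst []              _     _               = ⇔-refl
    forcePetals-subst {e₁ = e₁} ((z · Ψ) ∷ Δ) agree (z-safe ∷ safe) =
      Σ.congˡ {k = equivalence} (λ {e''} → ⇔-refl ×-⇔
        forceFs-subst Ψ (update-∘-₋ e₁ agree z-safe e'') (++⁻ˡ (bindersFs Ψ) (CaptureFree-₋ z safe)))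
      ⊎-⇔ forcePetals-subst Δ agree (++⁻ʳ (bindersFs Ψ) safe)

mainTheorem17 : ∀ {ℓ : Level} {S : Signature}
                  (x y : Sprinkler) (Φ : List (Flower S)) (Δ : List (Garden S))
                  (σ : Subst) →
                  HasSupport σ y →
                  CaptureAvoiding σ y ([] · Φ ▷ Δ) →
                  WellFormed ((x ∪ y) · Φ ▷ Δ) →
                  WellFormed (x · substFs σ Φ ▷ substGs σ Δ) →
                  _⊨_ {ℓ} ((x ∪ y) · Φ ▷ Δ) (x · substFs σ Φ ▷ substGs σ Δ)
mainTheorem17 x y Φ Δ σ σ:y avoids _ _ K w e e-eval premise w' w≤w' e' e'-eval σΦ =
  from (forcePetals-subst K Δ agree (++⁻ʳ (bindersFs Φ) safe))
       (premise w' w≤w' (e₁ ∘ σ) (e₁-eval ∘ σ)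
                (to (forceFs-subst K Φ agree (++⁻ˡ (bindersFs Φ) safe)) σΦ))
  where
  open Kripke K using (D; IsEval)
  supported : SupportedIn σ y
  supported v = to (σ:y v)
  e₁ : ℕ → D
  e₁ = e [ x ↦ e' ]
  e₁-eval : IsEval w' e₁
  e₁-eval = IsEval-update K x e-eval w≤w' e'-eval
  agree : e [ x ∪ y ↦ e₁ ∘ σ ] ≗ e₁ ∘ σ
  agree = update-∪-∘ x e e₁ supported (update-∉ e e')
  safe : CaptureFree σ (bindersFs Φ ++ bindersGs Δ)
  safe = captureFree _ (λ v moved → avoids v (supported v moved) ∘ there)
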